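{- $\dim_{ms}(P_5\boxtimes P_5)=\dim_{ms}(P_6\boxtimes P_6)=4$.
   Context: $P_n$ is the path on $n$ vertices. The strong product $G\boxtimes H$ has vertex set $V(G)\times V(H)$, with $(g,h)$ and $(g',h')$ adjacent iff ($g=g'$ and $hh'\in E(H)$) or ($gg'\in E(G)$ and $h=h'$) or ($gg'\in E(G)$ and $hh'\in E(H)$). For a connected graph $G$ with distance $d_G$, $u\in V(G)$ and $W=\{w_1,\dots,w_t\}\subseteq V(G)$, $\mathrm{m}_G(u|W)=\{\!\{d_G(u,w_1),\dots,d_G(u,w_t)\}\!\}$ (a multiset). $W$ is a multiset resolving set if the multisets $\mathrm{m}_G(u|W)$, $u\in V(G)$, are pairwise distinct; $\dim_{ms}(G)$ is the minimum cardinality of a multiset resolving set ($\infty$ if none exists). -}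

module Defs where

open import Data.Nat using (ℕ; zero; suc; _+_; _≤_)
open import Data.Fin using (Fin; toℕ)
open import Data.Product using (_×_; _,_; ∃-syntax; Σ)
open import Data.Sum using (_⊎_)
open import Data.List using (List; length)
open import Data.List.Relation.Unary.Unique.Propositional using (Unique)
open import Data.List.Relation.Binary.Pointwise using (Pointwise)
open import Data.List.Relation.Binary.Permutation.Propositional using (_↭_)
open import Relation.Binary.PropositionalEquality using (_≡_)

record Graph : Set₁ where
  field
    V   : Set
    Adj : V → V → Set
open Graph public

P : ℕ → Graph
P n = record
  { V   = Fin n
  ; Adj = λ i j → (suc (toℕ i) ≡ toℕ j) ⊎ (suc (toℕ j) ≡ toℕ i) }

_⊠_ : Graph → Graph → Graph
G ⊠ H = record
  { V   = V G × V H
  ; Adj = λ { (g , h) (g' , h') →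
              (g ≡ g' × Adj H h h')
            ⊎ (Adj G g g' × h ≡ h')
            ⊎ (Adj G g g' × Adj H h h') } }

data Walk (G : Graph) : V G → V G → ℕ → Set where
  stay : ∀ {u} → Walk G u u zero
  step : ∀ {u v w k} → Adj G u v → Walk G v w k → Walk G u w (suc k)

Dist : (G : Graph) → V G → V G → ℕ → Set
Dist G u v k = Walk G u v k × (∀ m → Walk G u v m → k ≤ m)

-- ds is (a listing of) the multiset m_G(u | W): ds lists d_G(u,w) for w in W, in order.
MDist : (G : Graph) → V G → List (V G) → List ℕ → Set
MDist G u W ds = Pointwise (Dist G u) W ds

MSResolving : (G : Graph) → List (V G) → Set
MSResolving G W =
  ∀ u v ds es → MDist G u W ds → MDist G v W es → ds ↭ es → u ≡ v

MSDim : Graph → ℕ → Set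
MSDim G k =
  (Σ (List (V G)) λ W → Unique W × length W ≡ k × MSResolving G W)
  × (∀ (W : List (V G)) → Unique W → MSResolving G W → k ≤ length W)

{-# OPTIONS --safe #-}
-- Distances in P m ⊠ P n are Chebyshev distances ∣a − c∣ ⊔ ∣b − d∣: every step changes each
-- coordinate by at most one, and a walk moving diagonally for as long as both coordinates
-- still differ attains the bound.  The multiset of distances from a vertex to W is then
-- faithfully represented by the sorted list of these numbers, its profile.  So W resolves
-- iff profiles are injective, which is checked by evaluation for the explicit sets W₅ and
-- W₆; and a duplicate-free list of at most three vertices fails to resolve as soon as two
-- distinct vertices share their profile, which a short list of candidate pairs always
-- exhibits.
module Submission where

open import Defs
open import Data.Bool using (Bool; T; true; _∧_)
open import Data.Bool.Properties using (T-∧)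
open import Data.Bool.ListAction using (all)
open import Data.Nat using (ℕ; zero; suc; _≤_; _<_; _⊔_; ∣_-_∣; z≤n; s≤s)
open import Data.Nat.Properties
  using (≤-trans; ≤-reflexive; ≤-antisym; ≮⇒≥; ⊔-mono-≤; +-monoˡ-≤;
         ∣n-n∣≡0; ∣-∣-identityʳ; ∣-∣-triangle; ≤-totalOrder; ≤-decTotalOrder)
import Data.Nat.Properties as ℕ
open import Data.Fin using (Fin; zero; suc; toℕ; #_)
import Data.Fin.Properties as Fin
open import Data.Product using (_×_; _,_; proj₁; proj₂)
open import Data.Product.Properties using (≡-dec)
open import Data.Sum using (_⊎_; inj₁; inj₂)
import Data.Sum as Sum
open import Data.List using (List; []; _∷_; map; length; allFin; cartesianProduct)
import Data.List.Properties as List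
open import Data.List.Membership.Propositional using (_∈_)
open import Data.List.Membership.Propositional.Properties using (∈-allFin; ∈-cartesianProduct⁺)
open import Data.List.Relation.Binary.Pointwise using ([]; _∷_; Pointwise-≡⇒≡)
open import Data.List.Relation.Binary.Permutation.Propositional using (_↭_; ↭-sym; ↭-trans; ↭⇒↭ₛ)
open import Data.List.Relation.Unary.All using (lookup)
open import Data.List.Relation.Unary.All.Properties using (all⁺)
open import Data.List.Relation.Unary.Any using (any?; satisfied)
open import Data.List.Relation.Unary.Unique.Propositional using (Unique)
open import Data.List.Relation.Unary.Sorted.TotalOrder.Properties using (↗↭↗⇒≋)
-- Insertion sort rather than Data.List.Sort, whose sort is abstract and would not evaluate.
open import Data.List.Sort.InsertionSort ≤-decTotalOrder using (sort)
open import Data.List.Sort.InsertionSort.Properties ≤-decTotalOrder using (sort-↭; sort-↗)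
open import Function using (_∘_; case_of_)
open import Function.Bundles using (Equivalence)
open import Relation.Binary.Definitions using (DecidableEquality)
open import Relation.Binary.PropositionalEquality using (_≡_; refl; sym; cong; cong₂; subst; subst₂)
open import Relation.Nullary using (¬_; ¬?; _×-dec_; _→-dec_)
open import Relation.Nullary.Decidable using (isYes; True; toWitness)
open import Relation.Unary using (Decidable)

private variable
  G H : Graph
  k l m n : ℕ

walk-snoc : ∀ {u v w} → Walk G u v k → Adj G v w → Walk G u w (suc k)
walk-snoc stay       e = step e stay
walk-snoc (step d p) e = step d (walk-snoc p e)

walk-map : ∀ {u v} (f : V G → V H) → (∀ {x y} → Adj G x y → Adj H (f x) (f y)) →
           Walk G u v k → Walk H (f u) (f v) k
walk-map f f-adj stay       = stay
walk-map f f-adj (step e p) = step (f-adj e) (walk-map f f-adj p)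

walk-⊠ : ∀ {g g′ h h′} → Walk G g g′ k → Walk H h h′ l →
         Walk (G ⊠ H) (g , h) (g′ , h′) (k ⊔ l)
walk-⊠ stay           q          = walk-map (_ ,_) (λ e → inj₁ (refl , e)) q
walk-⊠ p@(step _ _)   stay       = walk-map (_, _) (λ d → inj₂ (inj₁ (d , refl))) p
walk-⊠ (step d p)     (step e q) = step (inj₂ (inj₂ (d , e))) (walk-⊠ p q)

walk-P-suc : ∀ {i j : Fin n} → Walk (P n) i j k → Walk (P (suc n)) (suc i) (suc j) k
walk-P-suc = walk-map {G = P _} {H = P _} suc (Sum.map (cong suc) (cong suc))

walk-P : (i j : Fin n) → Walk (P n) i j ∣ toℕ i - toℕ j ∣
walk-P zero    zero    = stay
walk-P (suc i) (suc j) = walk-P-suc (walk-P i j)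
walk-P {n = suc (suc _)} zero (suc j) =
  step (inj₁ refl) (walk-P-suc (walk-P zero j))
walk-P {n = suc (suc _)} (suc i) zero =
  subst (Walk (P _) (suc i) zero) (cong suc (∣-∣-identityʳ (toℕ i)))
    (walk-snoc (walk-P-suc (walk-P i zero)) (inj₂ refl))

module _ (δ : V G → V G → ℕ)
         (δ-refl : ∀ x → δ x x ≡ 0)
         (δ-step : ∀ {x y} z → Adj G x y → δ x z ≤ suc (δ y z)) where

  δ≤walk-length : ∀ {u w} → Walk G u w k → δ u w ≤ k
  δ≤walk-length {u = u} stay = ≤-reflexive (δ-refl u)
  δ≤walk-length {w = w} (step e p) = ≤-trans (δ-step w e) (s≤s (δ≤walk-length p))

Adj⁼ : (G : Graph) → V G → V G → Set
Adj⁼ G x y = x ≡ y ⊎ Adj G x y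

⊠-Adj⇒Adj⁼ : ∀ {g g′ h h′} → Adj (G ⊠ H) (g , h) (g′ , h′) → Adj⁼ G g g′ × Adj⁼ H h h′
⊠-Adj⇒Adj⁼ (inj₁ (g≡g′ , e))        = inj₁ g≡g′ , inj₂ e
⊠-Adj⇒Adj⁼ (inj₂ (inj₁ (d , h≡h′))) = inj₂ d , inj₁ h≡h′
⊠-Adj⇒Adj⁼ (inj₂ (inj₂ (d , e)))    = inj₂ d , inj₂ e

∣m-1+m∣≡1 : ∀ m → ∣ m - suc m ∣ ≡ 1
∣m-1+m∣≡1 zero    = refl
∣m-1+m∣≡1 (suc m) = ∣m-1+m∣≡1 m

∣1+m-m∣≡1 : ∀ m → ∣ suc m - m ∣ ≡ 1
∣1+m-m∣≡1 zero    = refl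
∣1+m-m∣≡1 (suc m) = ∣1+m-m∣≡1 m

P-Adj⁼⇒∣-∣≤1 : ∀ {i j : Fin n} → Adj⁼ (P n) i j → ∣ toℕ i - toℕ j ∣ ≤ 1
P-Adj⁼⇒∣-∣≤1 {i = i} (inj₁ refl) = ≤-trans (≤-reflexive (∣n-n∣≡0 (toℕ i))) z≤n
P-Adj⁼⇒∣-∣≤1 {i = i} (inj₂ (inj₁ e)) rewrite sym e = ≤-reflexive (∣m-1+m∣≡1 (toℕ i))
P-Adj⁼⇒∣-∣≤1 {j = j} (inj₂ (inj₂ e)) rewrite sym e = ≤-reflexive (∣1+m-m∣≡1 (toℕ j))

chebyshev : Fin m × Fin n → Fin m × Fin n → ℕ
chebyshev (a , b) (c , d) = ∣ toℕ a - toℕ c ∣ ⊔ ∣ toℕ b - toℕ d ∣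

chebyshev-refl : (x : Fin m × Fin n) → chebyshev x x ≡ 0
chebyshev-refl (a , b) = cong₂ _⊔_ (∣n-n∣≡0 (toℕ a)) (∣n-n∣≡0 (toℕ b))

chebyshev-step : ∀ {m n} {x y} (z : Fin m × Fin n) → Adj (P m ⊠ P n) x y →
                 chebyshev x z ≤ suc (chebyshev y z)
chebyshev-step {m} {n} {_ , _} {_ , _} _ e
  with a⁼ , b⁼ ← ⊠-Adj⇒Adj⁼ {G = P m} {H = P n} e = ⊔-mono-≤ (coordinate a⁼) (coordinate b⁼)
  where
  coordinate : ∀ {k} {i j t : Fin k} → Adj⁼ (P k) i j →
               ∣ toℕ i - toℕ t ∣ ≤ suc ∣ toℕ j - toℕ t ∣
  coordinate {i = i} {j} {t} i⁼j =
    ≤-trans (∣-∣-triangle (toℕ i) (toℕ j) (toℕ t)) (+-monoˡ-≤ _ (P-Adj⁼⇒∣-∣≤1 i⁼j))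

dist-P⊠P : (x y : Fin m × Fin n) → Dist (P m ⊠ P n) x y (chebyshev x y)
dist-P⊠P (a , b) (c , d) =
  walk-⊠ (walk-P a c) (walk-P b d) ,
  λ _ → δ≤walk-length chebyshev chebyshev-refl chebyshev-step

Dist-unique : ∀ {u v l} → Dist G u v k → Dist G u v l → k ≡ l
Dist-unique (p , p-min) (q , q-min) = ≤-antisym (p-min _ q) (q-min _ p)

MDist-unique : ∀ {u W ds es} → MDist G u W ds → MDist G u W es → ds ≡ es
MDist-unique []       []       = refl
MDist-unique (d ∷ ds) (e ∷ es) rewrite Dist-unique d e | MDist-unique ds es = refl

↭⇒sort≡ : ∀ {xs ys} → xs ↭ ys → sort xs ≡ sort ys
↭⇒sort≡ {xs} {ys} xs↭ys = Pointwise-≡⇒≡ (↗↭↗⇒≋ ≤-totalOrder (sort-↗ xs) (sort-↗ ys)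
  (↭⇒↭ₛ (↭-trans (sort-↭ xs) (↭-trans xs↭ys (↭-sym (sort-↭ ys))))))

sort≡⇒↭ : ∀ {xs ys} → sort xs ≡ sort ys → xs ↭ ys
sort≡⇒↭ {xs} {ys} eq = ↭-trans (↭-sym (sort-↭ xs)) (subst (_↭ ys) (sym eq) (sort-↭ ys))

module Profiles (G : Graph) (δ : V G → V G → ℕ) (dist : ∀ u v → Dist G u v (δ u v)) where

  profile : List (V G) → V G → List ℕ
  profile W u = sort (map (δ u) W)

  MDist-map : ∀ u W → MDist G u W (map (δ u) W)
  MDist-map u []      = []
  MDist-map u (w ∷ W) = dist u w ∷ MDist-map u W

  MDist⇒≡map : ∀ {u W ds} → MDist G u W ds → ds ≡ map (δ u) W
  MDist⇒≡map {u} {W} p = MDist-unique p (MDist-map u W)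

  profile-injective⇒MSResolving : ∀ W → (∀ u v → profile W u ≡ profile W v → u ≡ v) →
                                  MSResolving G W
  profile-injective⇒MSResolving W injective u v ds es p q ds↭es =
    injective u v (subst₂ (λ xs ys → sort xs ≡ sort ys) (MDist⇒≡map p) (MDist⇒≡map q)
                          (↭⇒sort≡ ds↭es))

  profile-collision⇒¬MSResolving : ∀ {W u v} → ¬ u ≡ v → profile W u ≡ profile W v →
                                   ¬ MSResolving G W
  profile-collision⇒¬MSResolving {W} {u} {v} u≢v eq resolving =
    u≢v (resolving u v _ _ (MDist-map u W) (MDist-map v W) (sort≡⇒↭ eq))

MSDim-intro : ∀ W → Unique W → MSResolving G W →
              (∀ W′ → length W′ < length W → Unique W′ → ¬ MSResolving G W′) →
              MSDim G (length W)
MSDim-intro W unique resolving too-short =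
  (W , unique , refl , resolving) ,
  λ W′ unique′ resolving′ → ≮⇒≥ λ shorter → too-short W′ shorter unique′ resolving′

-- The searches are Bool-valued: Dec-valued ones evaluated over all triples of vertices
-- also build their evidence, which exhausts the type checker's memory.
module _ {A : Set} {xs : List A} (complete : ∀ x → x ∈ xs) where

  all-sound : ∀ p → T (all p xs) → ∀ x → T (p x)
  all-sound p holds x = lookup (all⁺ p xs holds) (complete x)

  allShorterThan : ℕ → (List A → Bool) → Bool
  allShorterThan zero    p = true
  allShorterThan (suc k) p = p [] ∧ all (λ x → allShorterThan k (p ∘ (x ∷_))) xs

  allShorterThan-sound : ∀ k p → T (allShorterThan k p) → ∀ ys → length ys < k → T (p ys)
  allShorterThan-sound (suc k) p holds [] _ = proj₁ (Equivalence.to (T-∧ {p []}) holds)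
  allShorterThan-sound (suc k) p holds (y ∷ ys) (s≤s short) =
    allShorterThan-sound k (p ∘ (y ∷_))
      (all-sound _ (proj₂ (Equivalence.to (T-∧ {p []}) holds)) y) ys short

module StrongProductOfPaths (m n : ℕ) where
  open Profiles (P m ⊠ P n) chebyshev dist-P⊠P

  Vertex : Set
  Vertex = Fin m × Fin n

  _≟_ : DecidableEquality Vertex
  _≟_ = ≡-dec Fin._≟_ Fin._≟_

  open import Data.List.Relation.Unary.Unique.DecPropositional _≟_ using (unique?)

  vertices : List Vertex
  vertices = cartesianProduct (allFin m) (allFin n)

  ∈-vertices : ∀ x → x ∈ vertices
  ∈-vertices (a , b) = ∈-cartesianProduct⁺ (∈-allFin a) (∈-allFin b)

  _≟ₚ_ : DecidableEquality (List ℕ)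
  _≟ₚ_ = List.≡-dec ℕ._≟_

  isProfileInjective : List Vertex → Bool
  isProfileInjective W = all (λ u → all (λ v →
    isYes (profile W u ≟ₚ profile W v →-dec u ≟ v)) vertices) vertices

  isProfileInjective-sound : ∀ W → T (isProfileInjective W) →
                             ∀ u v → profile W u ≡ profile W v → u ≡ v
  isProfileInjective-sound W holds u v =
    toWitness (all-sound ∈-vertices _ (all-sound ∈-vertices _ holds u) v)

  ProfileCollision : List Vertex → Vertex × Vertex → Set
  ProfileCollision W (u , v) = ¬ u ≡ v × profile W u ≡ profile W v

  profile-collision? : ∀ W → Decidable (ProfileCollision W)
  profile-collision? W (u , v) = ¬? (u ≟ v) ×-dec profile W u ≟ₚ profile W v

  refutedBy : List (Vertex × Vertex) → List Vertex → Bool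
  refutedBy cs W = isYes (unique? W →-dec any? (profile-collision? W) cs)

  MSDim-P⊠P : ∀ W cs → True (unique? W) → T (isProfileInjective W) →
              T (allShorterThan ∈-vertices (length W) (refutedBy cs)) →
              MSDim (P m ⊠ P n) (length W)
  MSDim-P⊠P W cs unique injective refuted =
    MSDim-intro W (toWitness unique)
      (profile-injective⇒MSResolving W (isProfileInjective-sound W injective))
      λ W′ shorter unique′ →
        case satisfied (toWitness (allShorterThan-sound ∈-vertices _ _ refuted W′ shorter)
                                  unique′) of λ where
          (_ , u≢v , same) → profile-collision⇒¬MSResolving u≢v same

open StrongProductOfPaths using (MSDim-P⊠P)

W₅ : List (Fin 5 × Fin 5)
W₅ = (# 0 , # 0) ∷ (# 0 , # 1) ∷ (# 0 , # 4) ∷ (# 4 , # 0) ∷ []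

-- Found by computer search: each duplicate-free list of fewer than four vertices has
-- a profile collision among these pairs.
collisions₅ : List ((Fin 5 × Fin 5) × (Fin 5 × Fin 5))
collisions₅
  = ((# 0 , # 1) , (# 0 , # 2)) ∷ ((# 4 , # 2) , (# 4 , # 3)) ∷ ((# 1 , # 0) , (# 3 , # 0)) ∷ ((# 1 , # 4) , (# 2 , # 4)) ∷
    ((# 2 , # 0) , (# 3 , # 0)) ∷ ((# 2 , # 1) , (# 2 , # 3)) ∷ ((# 1 , # 2) , (# 3 , # 2)) ∷ ((# 1 , # 1) , (# 3 , # 3)) ∷
    ((# 1 , # 3) , (# 3 , # 1)) ∷ ((# 1 , # 0) , (# 2 , # 0)) ∷ ((# 0 , # 2) , (# 0 , # 3)) ∷ ((# 2 , # 4) , (# 3 , # 4)) ∷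
    ((# 4 , # 0) , (# 4 , # 1)) ∷ ((# 2 , # 2) , (# 2 , # 3)) ∷ ((# 2 , # 2) , (# 3 , # 2)) ∷ ((# 2 , # 1) , (# 2 , # 2)) ∷
    ((# 1 , # 1) , (# 3 , # 2)) ∷ ((# 1 , # 4) , (# 4 , # 0)) ∷ ((# 3 , # 0) , (# 4 , # 0)) ∷ ((# 2 , # 1) , (# 3 , # 3)) ∷
    ((# 2 , # 0) , (# 3 , # 4)) ∷ ((# 2 , # 3) , (# 3 , # 2)) ∷ ((# 3 , # 4) , (# 4 , # 4)) ∷ ((# 1 , # 2) , (# 2 , # 3)) ∷
    ((# 0 , # 1) , (# 4 , # 2)) ∷ ((# 0 , # 2) , (# 4 , # 3)) ∷ ((# 4 , # 3) , (# 4 , # 4)) ∷ ((# 1 , # 0) , (# 4 , # 2)) ∷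
    ((# 0 , # 0) , (# 1 , # 0)) ∷ []

W₆ : List (Fin 6 × Fin 6)
W₆ = (# 0 , # 0) ∷ (# 0 , # 4) ∷ (# 1 , # 4) ∷ (# 5 , # 5) ∷ []

collisions₆ : List ((Fin 6 × Fin 6) × (Fin 6 × Fin 6))
collisions₆
  = ((# 0 , # 2) , (# 0 , # 3)) ∷ ((# 5 , # 2) , (# 5 , # 3)) ∷ ((# 2 , # 0) , (# 3 , # 0)) ∷ ((# 2 , # 4) , (# 3 , # 4)) ∷
    ((# 2 , # 2) , (# 3 , # 2)) ∷ ((# 2 , # 2) , (# 2 , # 3)) ∷ ((# 3 , # 5) , (# 4 , # 5)) ∷ ((# 1 , # 5) , (# 2 , # 5)) ∷
    ((# 4 , # 0) , (# 5 , # 0)) ∷ ((# 0 , # 0) , (# 1 , # 0)) ∷ ((# 3 , # 2) , (# 3 , # 3)) ∷ ((# 2 , # 2) , (# 3 , # 3)) ∷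
    ((# 2 , # 3) , (# 3 , # 2)) ∷ ((# 0 , # 0) , (# 0 , # 1)) ∷ ((# 5 , # 0) , (# 5 , # 1)) ∷ ((# 2 , # 3) , (# 3 , # 3)) ∷
    ((# 1 , # 3) , (# 3 , # 3)) ∷ ((# 2 , # 3) , (# 4 , # 3)) ∷ ((# 0 , # 1) , (# 0 , # 3)) ∷ ((# 2 , # 2) , (# 2 , # 4)) ∷
    ((# 2 , # 2) , (# 4 , # 2)) ∷ ((# 0 , # 1) , (# 2 , # 5)) ∷ ((# 0 , # 3) , (# 1 , # 5)) ∷ ((# 1 , # 5) , (# 5 , # 3)) ∷
    ((# 3 , # 1) , (# 3 , # 3)) ∷ ((# 0 , # 1) , (# 5 , # 4)) ∷ ((# 1 , # 5) , (# 4 , # 0)) ∷ ((# 0 , # 0) , (# 1 , # 5)) ∷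
    ((# 0 , # 1) , (# 2 , # 0)) ∷ []


proposition5 : MSDim (P 5 ⊠ P 5) 4 × MSDim (P 6 ⊠ P 6) 4
proposition5 = MSDim-P⊠P 5 5 W₅ collisions₅ _ _ _ , MSDim-P⊠P 6 6 W₆ collisions₆ _ _ _
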